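{- Let $\mathcal{C}$ be a category with binary coproducts and $H\colon\mathcal{C}\to\mathcal{C}$ a cia functor. Then for every object $Y$ of $\mathcal{C}$ the functor $H(-)+Y$ is a cia functor.
   Context: For an endofunctor $G$, a $G$-algebra $a\colon GA\to A$ is corecursive if for every coalgebra $e\colon X\to GX$ there is a unique $e^\dagger\colon X\to A$ with $e^\dagger=a\cdot Ge^\dagger\cdot e$; it is a cia (completely iterative algebra) if for every $e\colon X\to GX+A$ there is a unique $e^\dagger\colon X\to A$ with $e^\dagger=[a,\mathrm{id}_A]\cdot(Ge^\dagger+\mathrm{id}_A)\cdot e$. $G$ is a cia functor if every corecursive $G$-algebra is a cia. -}

module Defs where

open import Level using (Level; _⊔_; suc)
open import Data.Product using (Σ; _×_; _,_; proj₁; proj₂)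
open import Relation.Binary using (Rel; IsEquivalence)

record Category (o ℓ e : Level) : Set (suc (o ⊔ ℓ ⊔ e)) where
  infixr 9 _∘_
  infix  4 _≈_ _⇒_
  field
    Obj   : Set o
    _⇒_   : Obj → Obj → Set ℓ
    _≈_   : ∀ {A B} → Rel (A ⇒ B) e
    id    : ∀ {A} → A ⇒ A
    _∘_   : ∀ {A B C} → B ⇒ C → A ⇒ B → A ⇒ C
    equiv : ∀ {A B} → IsEquivalence (_≈_ {A} {B})
    assoc : ∀ {A B C D} {f : A ⇒ B} {g : B ⇒ C} {h : C ⇒ D} →
            (h ∘ g) ∘ f ≈ h ∘ (g ∘ f)
    identityˡ : ∀ {A B} {f : A ⇒ B} → id ∘ f ≈ f
    identityʳ : ∀ {A B} {f : A ⇒ B} → f ∘ id ≈ f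
    ∘-resp-≈  : ∀ {A B C} {f h : B ⇒ C} {g i : A ⇒ B} →
                f ≈ h → g ≈ i → f ∘ g ≈ h ∘ i

record Endofunctor {o ℓ e} (C : Category o ℓ e) : Set (o ⊔ ℓ ⊔ e) where
  open Category C
  field
    F₀ : Obj → Obj
    F₁ : ∀ {A B} → A ⇒ B → F₀ A ⇒ F₀ B
    identity     : ∀ {A} → F₁ (id {A}) ≈ id
    homomorphism : ∀ {A B C} {f : A ⇒ B} {g : B ⇒ C} →
                   F₁ (g ∘ f) ≈ F₁ g ∘ F₁ f
    F-resp-≈     : ∀ {A B} {f g : A ⇒ B} → f ≈ g → F₁ f ≈ F₁ g

record BinaryCoproducts {o ℓ e} (C : Category o ℓ e) : Set (o ⊔ ℓ ⊔ e) where
  open Category C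
  infixr 6 _+_
  field
    _+_   : Obj → Obj → Obj
    i₁    : ∀ {A B} → A ⇒ A + B
    i₂    : ∀ {A B} → B ⇒ A + B
    [_,_] : ∀ {A B X} → A ⇒ X → B ⇒ X → A + B ⇒ X
    inject₁ : ∀ {A B X} {f : A ⇒ X} {g : B ⇒ X} → [ f , g ] ∘ i₁ ≈ f
    inject₂ : ∀ {A B X} {f : A ⇒ X} {g : B ⇒ X} → [ f , g ] ∘ i₂ ≈ g
    unique  : ∀ {A B X} {f : A ⇒ X} {g : B ⇒ X} {h : A + B ⇒ X} →
              h ∘ i₁ ≈ f → h ∘ i₂ ≈ g → [ f , g ] ≈ h

  _+₁_ : ∀ {A B A' B'} → A ⇒ A' → B ⇒ B' → A + B ⇒ A' + B'
  f +₁ g = [ i₁ ∘ f , i₂ ∘ g ]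

module _ {o ℓ e} {C : Category o ℓ e} (CP : BinaryCoproducts C)
         (G : Endofunctor C) where
  open Category C
  open BinaryCoproducts CP
  open Endofunctor G

  -- ∃! up to the hom-setoid equality
  IsCorecursive : ∀ {A} → F₀ A ⇒ A → Set (o ⊔ ℓ ⊔ e)
  IsCorecursive {A} a =
    ∀ {X} (ε : X ⇒ F₀ X) →
      Σ (X ⇒ A) λ s →
        (s ≈ a ∘ F₁ s ∘ ε) ×
        (∀ (t : X ⇒ A) → t ≈ a ∘ F₁ t ∘ ε → t ≈ s)

  IsCia : ∀ {A} → F₀ A ⇒ A → Set (o ⊔ ℓ ⊔ e)
  IsCia {A} a =
    ∀ {X} (ε : X ⇒ F₀ X + A) →
      Σ (X ⇒ A) λ s →
        (s ≈ [ a , id ] ∘ (F₁ s +₁ id) ∘ ε) ×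
        (∀ (t : X ⇒ A) → t ≈ [ a , id ] ∘ (F₁ t +₁ id) ∘ ε → t ≈ s)

  IsCiaFunctor : Set (o ⊔ ℓ ⊔ e)
  IsCiaFunctor = ∀ {A} (a : F₀ A ⇒ A) → IsCorecursive a → IsCia a

module _ {o ℓ e} {C : Category o ℓ e} (CP : BinaryCoproducts C) where
  open Category C
  open BinaryCoproducts CP
  private
    module E {A B} = IsEquivalence (equiv {A} {B})

    _⟩_ : ∀ {A B} {f g h : A ⇒ B} → f ≈ g → g ≈ h → f ≈ h
    p ⟩ q = E.trans p q
    infixr 2 _⟩_

    +-i₁ : ∀ {A B A' B'} {f : A ⇒ A'} {g : B ⇒ B'} → (f +₁ g) ∘ i₁ ≈ i₁ ∘ f
    +-i₁ = inject₁
    +-i₂ : ∀ {A B A' B'} {f : A ⇒ A'} {g : B ⇒ B'} → (f +₁ g) ∘ i₂ ≈ i₂ ∘ g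
    +-i₂ = inject₂

    +-id : ∀ {A B} → (id {A} +₁ id {B}) ≈ id
    +-id = unique (identityˡ ⟩ E.sym identityʳ) (identityˡ ⟩ E.sym identityʳ)

    +-∘ : ∀ {A B C' A' B' C''} {f : A ⇒ B} {g : B ⇒ C'}
            {f' : A' ⇒ B'} {g' : B' ⇒ C''} →
          ((g ∘ f) +₁ (g' ∘ f')) ≈ (g +₁ g') ∘ (f +₁ f')
    +-∘ {f = f} {g} {f'} {g'} =
      unique
        (assoc ⟩ ∘-resp-≈ E.refl +-i₁ ⟩ E.sym assoc ⟩
         ∘-resp-≈ +-i₁ E.refl ⟩ assoc)
        (assoc ⟩ ∘-resp-≈ E.refl +-i₂ ⟩ E.sym assoc ⟩
         ∘-resp-≈ +-i₂ E.refl ⟩ assoc)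

    +-resp : ∀ {A B A' B'} {f f' : A ⇒ A'} {g g' : B ⇒ B'} →
             f ≈ f' → g ≈ g' → (f +₁ g) ≈ (f' +₁ g')
    +-resp p q = unique (+-i₁ ⟩ ∘-resp-≈ E.refl (E.sym p))
                        (+-i₂ ⟩ ∘-resp-≈ E.refl (E.sym q))

  _+Y : Endofunctor C → Obj → Endofunctor C
  (H +Y) Y = record
    { F₀ = λ X → F₀ X + Y
    ; F₁ = λ f → F₁ f +₁ id {Y}
    ; identity = +-resp identity E.refl ⟩ +-id
    ; homomorphism = +-resp homomorphism (E.sym identityˡ) ⟩ +-∘
    ; F-resp-≈ = λ p → +-resp (F-resp-≈ p) E.refl
    }
    where open Endofunctor H

-- Split a corecursive algebra a : H A + Y → A as a = [ α , β ].  Feeding a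
-- coalgebra for H through i₁ shows that α is corecursive for H, hence a cia.
-- An equation X → (H X + Y) + A for a becomes an equation X → H X + A for α
-- by evaluating the Y-summand with β, and both have the same solutions.
module Submission where

open import Level using (_⊔_)
open import Data.Product using (Σ; _×_; _,_)
open import Relation.Binary using (Setoid)
import Relation.Binary.Reasoning.Setoid as SetoidReasoning
open import Defs

module _ {o ℓ e} {C : Category o ℓ e} where
  open Category C

  hom-setoid : Obj → Obj → Setoid ℓ e
  hom-setoid A B = record { isEquivalence = equiv {A} {B} }

  module HomReasoning {A B : Obj} where
    open SetoidReasoning (hom-setoid A B) public

  open module HomSetoid {A B : Obj} = Setoid (hom-setoid A B)
    using (refl; sym; trans)

  -- Both IsCorecursive and IsCia unfold to this, for suitable Φ.
  UniqueFixedPoint : ∀ {X A} → (X ⇒ A → X ⇒ A) → Set (ℓ ⊔ e)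
  UniqueFixedPoint Φ = Σ _ λ s → (s ≈ Φ s) × (∀ t → t ≈ Φ t → t ≈ s)

  uniqueFixedPoint-resp : ∀ {X A} {Φ Ψ : X ⇒ A → X ⇒ A} →
                          (∀ t → Φ t ≈ Ψ t) →
                          UniqueFixedPoint Φ → UniqueFixedPoint Ψ
  uniqueFixedPoint-resp Φ≈Ψ (s , s-fix , s-unique) =
    s , trans s-fix (Φ≈Ψ s) , λ t t-fix → s-unique t (trans t-fix (sym (Φ≈Ψ t)))

  assoc² : ∀ {A B B′ B″ D} {f : A ⇒ B} {g : B ⇒ B′} {h : B′ ⇒ B″} {k : B″ ⇒ D} →
            (k ∘ h ∘ g) ∘ f ≈ k ∘ h ∘ g ∘ f
  assoc² = trans assoc (∘-resp-≈ refl assoc)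

  module _ (CP : BinaryCoproducts C) where
    open BinaryCoproducts CP

    inject₁-∘ : ∀ {A B X Z} {f : A ⇒ X} {g : B ⇒ X} {h : Z ⇒ A} →
                [ f , g ] ∘ i₁ ∘ h ≈ f ∘ h
    inject₁-∘ = trans (sym assoc) (∘-resp-≈ inject₁ refl)

    inject₂-∘ : ∀ {A B X Z} {f : A ⇒ X} {g : B ⇒ X} {h : Z ⇒ B} →
                [ f , g ] ∘ i₂ ∘ h ≈ g ∘ h
    inject₂-∘ = trans (sym assoc) (∘-resp-≈ inject₂ refl)

    +₁-inject₁-∘ : ∀ {A B A' B' Z} {f : A ⇒ A'} {g : B ⇒ B'} {h : Z ⇒ A} →
                   (f +₁ g) ∘ i₁ ∘ h ≈ i₁ ∘ f ∘ h
    +₁-inject₁-∘ = trans inject₁-∘ assoc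

    +₁-inject₂-∘ : ∀ {A B A' B' Z} {f : A ⇒ A'} {g : B ⇒ B'} {h : Z ⇒ B} →
                   (f +₁ g) ∘ i₂ ∘ h ≈ i₂ ∘ g ∘ h
    +₁-inject₂-∘ = trans inject₂-∘ assoc

    +-ext : ∀ {A B X} {f g : A + B ⇒ X} →
            f ∘ i₁ ≈ g ∘ i₁ → f ∘ i₂ ≈ g ∘ i₂ → f ≈ g
    +-ext p q = trans (sym (unique refl refl)) (unique (sym p) (sym q))

    +-ext₃ : ∀ {A B D X} {f g : (A + B) + D ⇒ X} →
             f ∘ i₁ ∘ i₁ ≈ g ∘ i₁ ∘ i₁ → f ∘ i₁ ∘ i₂ ≈ g ∘ i₁ ∘ i₂ →
             f ∘ i₂ ≈ g ∘ i₂ → f ≈ g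
    +-ext₃ p q r = +-ext (+-ext (trans assoc (trans p (sym assoc)))
                                (trans assoc (trans q (sym assoc))))
                         r

    module _ (H : Endofunctor C) (Y : Obj) where
      open Endofunctor H
      open HomReasoning

      corecursive⇒restriction-corecursive : ∀ {A} (a : F₀ A + Y ⇒ A) →
                             IsCorecursive CP ((_+Y CP H) Y) a →
                             IsCorecursive CP H (a ∘ i₁)
      corecursive⇒restriction-corecursive a a-corec ε =
        uniqueFixedPoint-resp step (a-corec (i₁ ∘ ε))
        where
        step : ∀ t → a ∘ (F₁ t +₁ id) ∘ i₁ ∘ ε ≈ (a ∘ i₁) ∘ F₁ t ∘ ε
        step t = begin
          a ∘ (F₁ t +₁ id) ∘ i₁ ∘ ε  ≈⟨ ∘-resp-≈ refl +₁-inject₁-∘ ⟩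
          a ∘ i₁ ∘ F₁ t ∘ ε          ≈⟨ assoc ⟨
          (a ∘ i₁) ∘ F₁ t ∘ ε        ∎

      module _ {A} (a : F₀ A + Y ⇒ A) where
        evaluate-Y : ∀ {X} → (F₀ X + Y) + A ⇒ F₀ X + A
        evaluate-Y = [ [ i₁ , i₂ ∘ a ∘ i₂ ] , i₂ ]

        evaluate-Y-compatible : ∀ {X} (t : X ⇒ A) →
                                [ a ∘ i₁ , id ] ∘ (F₁ t +₁ id) ∘ evaluate-Y ≈
                                [ a , id ] ∘ ((F₁ t +₁ id) +₁ id)
        evaluate-Y-compatible {X} t = +-ext₃ (trans lhs-H (sym rhs-H))
                                         (trans lhs-Y (sym rhs-Y))
                                         (trans lhs-A (sym rhs-A))
          where
          lhs rhs : (F₀ X + Y) + A ⇒ A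
          lhs = [ a ∘ i₁ , id ] ∘ (F₁ t +₁ id) ∘ evaluate-Y
          rhs = [ a , id ] ∘ ((F₁ t +₁ id) +₁ id)

          lhs-H : lhs ∘ i₁ ∘ i₁ ≈ a ∘ i₁ ∘ F₁ t
          lhs-H = begin
            lhs ∘ i₁ ∘ i₁                                ≈⟨ assoc² ⟩
            [ a ∘ i₁ , id ] ∘ (F₁ t +₁ id) ∘ evaluate-Y ∘ i₁ ∘ i₁
              ≈⟨ ∘-resp-≈ refl (∘-resp-≈ refl (trans inject₁-∘ inject₁)) ⟩
            [ a ∘ i₁ , id ] ∘ (F₁ t +₁ id) ∘ i₁          ≈⟨ ∘-resp-≈ refl inject₁ ⟩
            [ a ∘ i₁ , id ] ∘ i₁ ∘ F₁ t                  ≈⟨ trans inject₁-∘ assoc ⟩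
            a ∘ i₁ ∘ F₁ t                                ∎

          rhs-H : rhs ∘ i₁ ∘ i₁ ≈ a ∘ i₁ ∘ F₁ t
          rhs-H = begin
            rhs ∘ i₁ ∘ i₁                                ≈⟨ assoc ⟩
            [ a , id ] ∘ ((F₁ t +₁ id) +₁ id) ∘ i₁ ∘ i₁  ≈⟨ ∘-resp-≈ refl +₁-inject₁-∘ ⟩
            [ a , id ] ∘ i₁ ∘ (F₁ t +₁ id) ∘ i₁          ≈⟨ inject₁-∘ ⟩
            a ∘ (F₁ t +₁ id) ∘ i₁                        ≈⟨ ∘-resp-≈ refl inject₁ ⟩
            a ∘ i₁ ∘ F₁ t                                ∎

          lhs-Y : lhs ∘ i₁ ∘ i₂ ≈ a ∘ i₂
          lhs-Y = begin
            lhs ∘ i₁ ∘ i₂                                ≈⟨ assoc² ⟩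
            [ a ∘ i₁ , id ] ∘ (F₁ t +₁ id) ∘ evaluate-Y ∘ i₁ ∘ i₂
              ≈⟨ ∘-resp-≈ refl (∘-resp-≈ refl (trans inject₁-∘ inject₂)) ⟩
            [ a ∘ i₁ , id ] ∘ (F₁ t +₁ id) ∘ i₂ ∘ a ∘ i₂ ≈⟨ ∘-resp-≈ refl +₁-inject₂-∘ ⟩
            [ a ∘ i₁ , id ] ∘ i₂ ∘ id ∘ a ∘ i₂           ≈⟨ inject₂-∘ ⟩
            id ∘ id ∘ a ∘ i₂                             ≈⟨ trans identityˡ identityˡ ⟩
            a ∘ i₂                                       ∎

          rhs-Y : rhs ∘ i₁ ∘ i₂ ≈ a ∘ i₂
          rhs-Y = begin
            rhs ∘ i₁ ∘ i₂                                ≈⟨ assoc ⟩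
            [ a , id ] ∘ ((F₁ t +₁ id) +₁ id) ∘ i₁ ∘ i₂  ≈⟨ ∘-resp-≈ refl +₁-inject₁-∘ ⟩
            [ a , id ] ∘ i₁ ∘ (F₁ t +₁ id) ∘ i₂          ≈⟨ inject₁-∘ ⟩
            a ∘ (F₁ t +₁ id) ∘ i₂                        ≈⟨ ∘-resp-≈ refl inject₂ ⟩
            a ∘ i₂ ∘ id                                  ≈⟨ ∘-resp-≈ refl identityʳ ⟩
            a ∘ i₂                                       ∎

          lhs-A : lhs ∘ i₂ ≈ id
          lhs-A = begin
            lhs ∘ i₂                                     ≈⟨ assoc² ⟩
            [ a ∘ i₁ , id ] ∘ (F₁ t +₁ id) ∘ evaluate-Y ∘ i₂
              ≈⟨ ∘-resp-≈ refl (∘-resp-≈ refl inject₂) ⟩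
            [ a ∘ i₁ , id ] ∘ (F₁ t +₁ id) ∘ i₂          ≈⟨ ∘-resp-≈ refl inject₂ ⟩
            [ a ∘ i₁ , id ] ∘ i₂ ∘ id                    ≈⟨ trans inject₂-∘ identityˡ ⟩
            id                                           ∎

          rhs-A : rhs ∘ i₂ ≈ id
          rhs-A = begin
            rhs ∘ i₂                                     ≈⟨ assoc ⟩
            [ a , id ] ∘ ((F₁ t +₁ id) +₁ id) ∘ i₂       ≈⟨ ∘-resp-≈ refl inject₂ ⟩
            [ a , id ] ∘ i₂ ∘ id                         ≈⟨ trans inject₂-∘ identityˡ ⟩
            id                                           ∎

        restriction-cia⇒cia : IsCia CP H (a ∘ i₁) → IsCia CP ((_+Y CP H) Y) a
        restriction-cia⇒cia restriction-cia ε =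
          uniqueFixedPoint-resp step (restriction-cia (evaluate-Y ∘ ε))
          where
          step : ∀ t → [ a ∘ i₁ , id ] ∘ (F₁ t +₁ id) ∘ evaluate-Y ∘ ε ≈
                       [ a , id ] ∘ ((F₁ t +₁ id) +₁ id) ∘ ε
          step t = begin
            [ a ∘ i₁ , id ] ∘ (F₁ t +₁ id) ∘ evaluate-Y ∘ ε
              ≈⟨ assoc² ⟨
            ([ a ∘ i₁ , id ] ∘ (F₁ t +₁ id) ∘ evaluate-Y) ∘ ε
              ≈⟨ ∘-resp-≈ (evaluate-Y-compatible t) refl ⟩
            ([ a , id ] ∘ ((F₁ t +₁ id) +₁ id)) ∘ ε
              ≈⟨ assoc ⟩
            [ a , id ] ∘ ((F₁ t +₁ id) +₁ id) ∘ ε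
              ∎

proposition4p6 : ∀ {o ℓ e} {C : Category o ℓ e} (CP : BinaryCoproducts C)
                   (H : Endofunctor C) →
                   IsCiaFunctor CP H →
                   (Y : Category.Obj C) → IsCiaFunctor CP ((_+Y CP H) Y)
proposition4p6 {C = C} CP H H-cia Y a a-corec =
  restriction-cia⇒cia CP H Y a
    (H-cia (a ∘ i₁) (corecursive⇒restriction-corecursive CP H Y a a-corec))
  where
  open Category C
  open BinaryCoproducts CP
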